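{- (Refl$_1$) and (Refl$_2$) are correct at every reflexive Kripke model.
   Context: Formulas are built from propositional letters and $\bot$ using $\land,\lor,\to$. For a frame $\mathfrak F=\langle W,R\rangle$, $X\subseteq W$: $\Box_{\mathfrak F}X=\{w\mid\forall v(wRv\Rightarrow v\in X)\}$, $\Diamond^{ -1}_{\mathfrak F}X=\{w\mid\exists x\in X,\ xRw\}$. In a Kripke model $\mathfrak M=\langle\mathfrak F,V\rangle$: $\|p\|=V(p)$, $\|\bot\|=\Box_{\mathfrak F}\emptyset$, $\|\alpha\land\beta\|=\|\alpha\|\cap\|\beta\|$, $\|\alpha\to\beta\|=\Box_{\mathfrak F}((W\setminus\|\alpha\|)\cup\|\beta\|)$, $\|\alpha\lor\beta\|=\Box_{\mathfrak F}\Diamond^{ -1}_{\mathfrak F}(\|\alpha\|\cup\|\beta\|)$. A rule is correct at $\mathfrak M$ iff $\vDash_{\mathfrak M}$ satisfies it, where $\alpha\vDash_{\mathfrak M}\beta$ iff every point satisfying $\alpha$ satisfies $\beta$, and "$\vDash_{\mathfrak M}\alpha$" means $\chi\vDash_{\mathfrak M}\alpha$ for every $\chi$. (Refl$_1$): for each $n\ge1$, if $\psi_j\land\beta_j\vdash\chi$ for every $1\le j\le n$ then $\bigwedge_j(\psi_j\land\alpha_j)\land\bigvee_j(\alpha_j\to\beta_j)\vdash\chi$. (Refl$_2$): $\bigwedge_{1\le j\le n}(\psi_j\land\beta_j\to\chi)\vdash\bigwedge_j(\psi_j\land\alpha_j)\land\bigvee_j(\alpha_j\to\beta_j)\to\chi$.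 -}

module Defs where

open import Data.Nat using (ℕ; zero; suc)
open import Data.Fin using (Fin; zero; suc)
open import Data.Product using (Σ; _×_; _,_)
open import Data.Sum using (_⊎_)
open import Data.Empty using (⊥)
open import Relation.Nullary using (¬_)
open import Function using (_∘_)

data Form : Set where
  var  : ℕ → Form
  bot  : Form
  _∧_  : Form → Form → Form
  _∨_  : Form → Form → Form
  _⇒_  : Form → Form → Form

infixr 6 _∧_
infixr 5 _∨_
infixr 4 _⇒_

record Frame : Set₁ where
  field
    W : Set
    R : W → W → Set

Subset : Set → Set₁
Subset W = W → Set

module _ (F : Frame) where
  open Frame F

  □ : Subset W → Subset W
  □ X w = ∀ v → R w v → X v

  ◇⁻¹ : Subset W → Subset W
  ◇⁻¹ X w = Σ W (λ x → X x × R x w)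

  ∅ : Subset W
  ∅ _ = ⊥

  _∪_ : Subset W → Subset W → Subset W
  (X ∪ Y) w = X w ⊎ Y w

  _∩_ : Subset W → Subset W → Subset W
  (X ∩ Y) w = X w × Y w

  compl : Subset W → Subset W
  compl X w = ¬ X w

  Reflexive : Set
  Reflexive = ∀ w → R w w

record Model : Set₁ where
  field
    frame : Frame
    V     : ℕ → Subset (Frame.W frame)

module _ (M : Model) where
  open Model M
  open Frame frame

  ⟦_⟧ : Form → Subset W
  ⟦ var p ⟧ = V p
  ⟦ bot ⟧ = □ frame (∅ frame)
  ⟦ α ∧ β ⟧ = _∩_ frame ⟦ α ⟧ ⟦ β ⟧
  ⟦ α ⇒ β ⟧ = □ frame (_∪_ frame (compl frame ⟦ α ⟧) ⟦ β ⟧)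
  ⟦ α ∨ β ⟧ = □ frame (◇⁻¹ frame (_∪_ frame ⟦ α ⟧ ⟦ β ⟧))

  _⊨_ : Form → Form → Set
  α ⊨ β = ∀ w → ⟦ α ⟧ w → ⟦ β ⟧ w

-- n-ary conjunction / disjunction over j = 1..n, n ≥ 1 (indexed by Fin (suc m), n = m+1),
-- bracketed to the right: f 0 ∧ (f 1 ∧ (... ∧ f m))
⋀ : ∀ {m} → (Fin (suc m) → Form) → Form
⋀ {zero}  f = f zero
⋀ {suc m} f = f zero ∧ ⋀ (f ∘ suc)

⋁ : ∀ {m} → (Fin (suc m) → Form) → Form
⋁ {zero}  f = f zero
⋁ {suc m} f = f zero ∨ ⋁ (f ∘ suc)

Refl₁-correct : Model → Set
Refl₁-correct M = ∀ m (ψ α β : Fin (suc m) → Form) (χ : Form) →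
  (∀ j → _⊨_ M (ψ j ∧ β j) χ) →
  _⊨_ M (⋀ (λ j → ψ j ∧ α j) ∧ ⋁ (λ j → α j ⇒ β j)) χ

Refl₂-correct : Model → Set
Refl₂-correct M = ∀ m (ψ α β : Fin (suc m) → Form) (χ : Form) →
  _⊨_ M (⋀ (λ j → ψ j ∧ β j ⇒ χ))
        ((⋀ (λ j → ψ j ∧ α j) ∧ ⋁ (λ j → α j ⇒ β j)) ⇒ χ)

ReflexiveModel : Model → Set
ReflexiveModel M = Reflexive (Model.frame M)

-- Reflexivity makes every point its own R-successor, so a disjunction ⋁ (αⱼ → βⱼ)
-- true at w supplies an R-predecessor of w where some αⱼ → βⱼ holds; as αⱼ holds
-- at w, so does βⱼ, i.e. the premise of both rules forces some ψⱼ ∧ βⱼ at w.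
-- (Refl₂) follows by applying this at each successor, which needs excluded middle
-- to split on whether the premise holds there.
module Submission where

open import Defs
open import Data.Nat using (zero; suc)
open import Data.Fin using (Fin; zero; suc)
open import Data.Product using (∃; _×_; _,_)
open import Data.Sum using (inj₁; inj₂)
open import Data.Empty using (⊥-elim)
open import Function using (_∘_)
open import Level using (0ℓ)
open import Axiom.ExcludedMiddle using (ExcludedMiddle)
open import Relation.Nullary using (yes; no)

Refl-premise : ∀ {m} → (ψ α β : Fin (suc m) → Form) → Form
Refl-premise ψ α β = ⋀ (λ j → ψ j ∧ α j) ∧ ⋁ (λ j → α j ⇒ β j)

module _ (M : Model) where
  open Model M
  open Frame frame

  ⟦⋀⟧-lookup : ∀ {m} (f : Fin (suc m) → Form) {w} →
    ⟦ M ⟧ (⋀ f) w → ∀ j → ⟦ M ⟧ (f j) w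
  ⟦⋀⟧-lookup {zero}  f h        zero    = h
  ⟦⋀⟧-lookup {suc m} f (h , _)  zero    = h
  ⟦⋀⟧-lookup {suc m} f (_ , hs) (suc j) = ⟦⋀⟧-lookup (f ∘ suc) hs j

  ⟦⋁⟧-◇⁻¹ : ∀ {m} (f : Fin (suc m) → Form) {x w} →
    ⟦ M ⟧ (⋁ f) x → R x w → ∃ λ j → ◇⁻¹ frame (⟦ M ⟧ (f j)) w
  ⟦⋁⟧-◇⁻¹ {zero}  f {x}     h rxw = zero , x , h , rxw
  ⟦⋁⟧-◇⁻¹ {suc m} f {w = w} h rxw with h w rxw
  ... | y , inj₁ h₀ , ryw = zero , y , h₀ , ryw
  ... | y , inj₂ hs , ryw with ⟦⋁⟧-◇⁻¹ (f ∘ suc) hs ryw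
  ...   | j , z = suc j , z

  ⟦⇒⟧-modus-ponens : ∀ α β {x w} →
    ⟦ M ⟧ (α ⇒ β) x → R x w → ⟦ M ⟧ α w → ⟦ M ⟧ β w
  ⟦⇒⟧-modus-ponens α β h rxw a with h _ rxw
  ... | inj₁ ¬a = ⊥-elim (¬a a)
  ... | inj₂ b  = b

  module _ (R-refl : Reflexive frame) where

    Refl-premise⇒some-ψ∧β : ∀ {m} (ψ α β : Fin (suc m) → Form) {w} →
      ⟦ M ⟧ (Refl-premise ψ α β) w → ∃ λ j → ⟦ M ⟧ (ψ j ∧ β j) w
    Refl-premise⇒some-ψ∧β ψ α β {w} (ψα , ⋁α⇒β)
      with ⟦⋁⟧-◇⁻¹ (λ j → α j ⇒ β j) ⋁α⇒β (R-refl w)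
    ... | j , y , αⱼ⇒βⱼ , ryw with ⟦⋀⟧-lookup (λ j → ψ j ∧ α j) ψα j
    ...   | ψⱼ , αⱼ = j , ψⱼ , ⟦⇒⟧-modus-ponens (α j) (β j) αⱼ⇒βⱼ ryw αⱼ

    refl₁-correct : Refl₁-correct M
    refl₁-correct m ψ α β χ ψ∧β⊨χ w premise with Refl-premise⇒some-ψ∧β ψ α β premise
    ... | j , ψ∧βⱼ = ψ∧β⊨χ j w ψ∧βⱼ

    refl₂-correct : ExcludedMiddle 0ℓ → Refl₂-correct M
    refl₂-correct em m ψ α β χ w ψ∧β⇒χ v rwv with em {⟦ M ⟧ (Refl-premise ψ α β) v}
    ... | no ¬premise = inj₁ ¬premise
    ... | yes premise with Refl-premise⇒some-ψ∧β ψ α β premise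
    ...   | j , ψ∧βⱼ = inj₂ (⟦⇒⟧-modus-ponens (ψ j ∧ β j) χ ψ∧βⱼ⇒χ rwv ψ∧βⱼ)
      where
      ψ∧βⱼ⇒χ : ⟦ M ⟧ (ψ j ∧ β j ⇒ χ) w
      ψ∧βⱼ⇒χ = ⟦⋀⟧-lookup (λ j → ψ j ∧ β j ⇒ χ) ψ∧β⇒χ j

lemma7 : ExcludedMiddle 0ℓ → (M : Model) → ReflexiveModel M →
    Refl₁-correct M × Refl₂-correct M
lemma7 em M R-refl = refl₁-correct M R-refl , refl₂-correct M R-refl em
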